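{- Let $\mathbb{G}$ be a non-compliant graph. Then $\mathbb{H}=\mathbb{G}\circ \mathbb{K}_n$ is a compliant graph and $_{\mathbb{H}}d_{td}(a_i,b_j)\leq 2\, {_{\mathbb{G}}d_{d}}(a_i).$
   Context: $\mathbb{G}$ has vertices $a_1,\dots,a_m$ and $\mathbb{K}_n$ has vertices $b_1,\dots,b_n$ ($n\ge 2$). The composition $\mathbb{G}\circ\mathbb{K}_n$ has vertex set $V(\mathbb{G})\times V(\mathbb{K}_n)$, with $(a,b)$ adjacent to $(a',b')$ iff $a$ is adjacent to $a'$ in $\mathbb{G}$, or $a=a'$ and $b$ adjacent to $b'$ in $\mathbb{K}_n$. A total dominating set (TDS) is a vertex set $S$ such that every vertex is adjacent to a vertex of $S$; a minimal TDS (MTDS) has no proper subset that is a TDS. A vertex is compliant if some MTDS contains it; a graph is compliant if all its vertices are, and non-compliant otherwise. For a compliant graph $\mathbb{X}$, $_{\mathbb{X}}d_{td}(a)=\min\{|S| : S \text{ an MTDS of } \mathbb{X} \text{ containing } a\}$. The domination degree $_{\mathbb{G}}d_d(a)$ is the minimum cardinality of a minimal dominating set of $\mathbb{G}$ containing $a$. -}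

module Defs where

open import Data.Nat using (ℕ; _*_; _≤_)
open import Data.Bool using (Bool; true; false; _∨_; _∧_; not; T)
open import Data.Fin using (Fin; remQuot; combine)
open import Data.Fin.Properties using (_≟_)
open import Data.Fin.Subset using (Subset; _∈_; _⊂_; ∣_∣)
open import Data.Product using (Σ; _×_; _,_; proj₁; proj₂; ∃)
open import Data.Sum using (_⊎_)
open import Relation.Nullary using (¬_)
open import Relation.Nullary.Decidable using (⌊_⌋)
open import Relation.Binary.PropositionalEquality using (_≡_)

record Graph : Set where
  field
    order : ℕ
    adj   : Fin order → Fin order → Bool

open Graph public

Adj : (G : Graph) → Fin (order G) → Fin (order G) → Set
Adj G u v = T (adj G u v)

IsSimple : Graph → Set
IsSimple G = (∀ u v → adj G u v ≡ adj G v u) × (∀ u → ¬ Adj G u u)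

K : ℕ → Graph
K n = record { order = n ; adj = λ b b' → not ⌊ b ≟ b' ⌋ }

-- composition (lexicographic product) G ∘ H; the vertex (a , b) is encoded as combine a b.
-- (a,b) ~ (a',b')  iff  a ~ a' in G, or a = a' and b ~ b' in H.
_∘G_ : Graph → Graph → Graph
G ∘G H = record
  { order = order G * order H
  ; adj   = λ x y →
      let ab  = remQuot {order G} (order H) x
          ab' = remQuot {order G} (order H) y
      in adj G (proj₁ ab) (proj₁ ab')
         ∨ (⌊ proj₁ ab ≟ proj₁ ab' ⌋ ∧ adj H (proj₂ ab) (proj₂ ab'))
  }

vtx : (G H : Graph) → Fin (order G) → Fin (order H) → Fin (order (G ∘G H))
vtx G H a b = combine a b

module _ (G : Graph) where

  IsTDS : Subset (order G) → Set
  IsTDS S = ∀ v → ∃ λ u → u ∈ S × Adj G u v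

  IsMTDS : Subset (order G) → Set
  IsMTDS S = IsTDS S × (∀ T → T ⊂ S → ¬ IsTDS T)

  IsDS : Subset (order G) → Set
  IsDS S = ∀ v → v ∈ S ⊎ (∃ λ u → u ∈ S × Adj G u v)

  IsMDS : Subset (order G) → Set
  IsMDS S = IsDS S × (∀ T → T ⊂ S → ¬ IsDS T)

  CompliantVertex : Fin (order G) → Set
  CompliantVertex a = ∃ λ S → IsMTDS S × a ∈ S

  Compliant : Set
  Compliant = ∀ a → CompliantVertex a

  NonCompliant : Set
  NonCompliant = ¬ Compliant

IsMinCard : {N : ℕ} → (Subset N → Set) → ℕ → Set
IsMinCard P k = (∃ λ S → P S × ∣ S ∣ ≡ k) × (∀ S → P S → k ≤ ∣ S ∣)

IsTotalDomDegree : (G : Graph) → Fin (order G) → ℕ → Set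
IsTotalDomDegree G a k = IsMinCard (λ S → IsMTDS G S × a ∈ S) k

IsDomDegree : (G : Graph) → Fin (order G) → ℕ → Set
IsDomDegree G a k = IsMinCard (λ S → IsMDS G S × a ∈ S) k

{-# OPTIONS --safe #-}
-- Take a minimal dominating set D of G containing a (a maximal independent set through a will
-- do) and a second vertex b′ of Kₙ. Stacking the layer D × {b} with a layer D′ × {b′}, where
-- D′ = D if a is isolated in D and D′ = D ∖ {a} otherwise, gives a total dominating set of
-- G ∘ Kₙ with at most 2|D| vertices, in which (a , b) is the only neighbour of some vertex:
-- of (a , b′) in the first case, of (y , b) for an external private neighbour y of a in the
-- second. Every minimal total dominating set inside it must therefore contain (a , b).
module Submission where

open import Defs
open import Data.Bool using (true; _∧_; _∨_; T)
open import Data.Bool.Properties using (T-∨; ∧-conicalˡ; ∧-conicalʳ)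
open import Data.Empty using (⊥-elim)
open import Data.Fin using (Fin; zero; suc; combine; remQuot; punchIn)
open import Data.Fin.Properties using (_≟_; any?; all?; ¬∀⟶∃¬; combine-remQuot; remQuot-combine; punchInᵢ≢i)
open import Data.Fin.Subset using (Subset; inside; outside; ⊥; ⁅_⁆; _∪_; _-_; ∁; _∈_; _∉_; _⊆_; _⊂_; ∣_∣)
open import Data.Fin.Subset.Properties
  using (_∈?_; _⊆?_; _⊂?_; anySubset?; ∣⊥∣≡0; ∣⁅x⁆∣≡1; ∣p∣≤∣x∷p∣; x∈⁅x⁆; x∈⁅y⁆⇒x≡y; ⊆-refl; ⊆-trans;
         p⊆q⇒∣p∣≤∣q∣; p⊂q⇒p⊆q; p⊂q⇒∣p∣<∣q∣; p⊂q⇒∁p⊃∁q; p⊆p∪q; x∈p∪q⁻; x∈p∪q⁺; p─q⊆p; x∈p∧x≢y⇒x∈p-y; x∈p⇒p-x⊂p)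
open import Data.Nat using (ℕ; _+_; _*_; _≤_; _<_; _≥_; _<?_; z≤n; s≤s)
open import Data.Nat.Induction using (<-wellFounded)
open import Data.Nat.Properties using (module ≤-Reasoning; ≤-reflexive; ≤-trans; <⇒≱; ≮⇒≥; +-suc; +-monoʳ-≤; +-identityʳ; *-identityʳ)
open import Data.Product using (∃; _×_; _,_; proj₁; proj₂)
open import Data.Sum using (_⊎_; inj₁; inj₂; [_,_])
import Data.Sum as Sum
open import Data.Vec using ([]; _∷_; _++_; lookup; there)
open import Data.Vec.Properties using (lookup-++ˡ; lookup-++ʳ; lookup-replicate; []=⇒lookup; lookup⇒[]=)
open import Function using (_∘_)
open import Function.Bundles using (Equivalence)
open import Induction.WellFounded using (Acc; acc)
open import Relation.Binary.Construct.On using () renaming (wellFounded to on-wellFounded)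
open import Relation.Binary.PropositionalEquality using (_≡_; _≢_; refl; sym; trans; cong; cong₂; subst; subst₂)
open import Relation.Nullary using (¬_; yes; no)
open import Relation.Nullary.Decidable using (⌊_⌋; _×-dec_; _⊎-dec_; _→-dec_; ¬?; map′; T?)
open import Relation.Unary using (Pred; Decidable)

open Equivalence using (to; from)

module _ {n : ℕ} {P : Subset n → Set} (P? : Decidable P) where

  argmin : (f : Subset n → ℕ) → ∀ {S} → P S → ∃ λ T → P T × (∀ T′ → P T′ → f T ≤ f T′)
  argmin f {S} = go S (on-wellFounded f <-wellFounded S)
    where
    go : ∀ S → Acc (λ T T′ → f T < f T′) S → P S → ∃ λ T → P T × (∀ T′ → P T′ → f T ≤ f T′)
    go S (acc smaller) pS with anySubset? (λ T → P? T ×-dec (f T <? f S))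
    ... | yes (T , pT , fT<fS) = go T (smaller fT<fS) pT
    ... | no ∄smaller = S , pS , λ T′ pT′ → ≮⇒≥ (λ fT′<fS → ∄smaller (T′ , pT′ , fT′<fS))

  minCard : ∀ {S} → P S → ∃ λ k → IsMinCard P k × k ≤ ∣ S ∣
  minCard {S} pS = let T , pT , minimum = argmin ∣_∣ pS in ∣ T ∣ , ((T , pT , refl) , minimum) , minimum S pS

∣p++q∣≡∣p∣+∣q∣ : ∀ {m n} (p : Subset m) (q : Subset n) → ∣ p ++ q ∣ ≡ ∣ p ∣ + ∣ q ∣
∣p++q∣≡∣p∣+∣q∣ []            q = refl
∣p++q∣≡∣p∣+∣q∣ (inside  ∷ p) q = cong (1 +_) (∣p++q∣≡∣p∣+∣q∣ p q)
∣p++q∣≡∣p∣+∣q∣ (outside ∷ p) q = ∣p++q∣≡∣p∣+∣q∣ p q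

∣p∪q∣≤∣p∣+∣q∣ : ∀ {n} (p q : Subset n) → ∣ p ∪ q ∣ ≤ ∣ p ∣ + ∣ q ∣
∣p∪q∣≤∣p∣+∣q∣ []            []            = z≤n
∣p∪q∣≤∣p∣+∣q∣ (inside  ∷ p) (s ∷ q)       = s≤s (≤-trans (∣p∪q∣≤∣p∣+∣q∣ p q) (+-monoʳ-≤ ∣ p ∣ (∣p∣≤∣x∷p∣ s q)))
∣p∪q∣≤∣p∣+∣q∣ (outside ∷ p) (inside  ∷ q) = ≤-trans (s≤s (∣p∪q∣≤∣p∣+∣q∣ p q)) (≤-reflexive (sym (+-suc ∣ p ∣ ∣ q ∣)))
∣p∪q∣≤∣p∣+∣q∣ (outside ∷ p) (outside ∷ q) = ∣p∪q∣≤∣p∣+∣q∣ p q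

x∉p-x : ∀ {n} (p : Subset n) x → x ∉ p - x
x∉p-x (_ ∷ p) zero    ()
x∉p-x (_ ∷ p) (suc x) (there x∈p-x) = x∉p-x p x x∈p-x

-- The vertex combine i j of Fin (m * n) lies in block i at offset j.
infixr 7 _⊗_
_⊗_ : ∀ {m n} → Subset m → Subset n → Subset (m * n)
[]            ⊗ q = []
(inside  ∷ p) ⊗ q = q ++ p ⊗ q
(outside ∷ p) ⊗ q = ⊥ ++ p ⊗ q

∣p⊗q∣≡∣p∣*∣q∣ : ∀ {m n} (p : Subset m) (q : Subset n) → ∣ p ⊗ q ∣ ≡ ∣ p ∣ * ∣ q ∣
∣p⊗q∣≡∣p∣*∣q∣ []            q = refl
∣p⊗q∣≡∣p∣*∣q∣ (inside  ∷ p) q = trans (∣p++q∣≡∣p∣+∣q∣ q (p ⊗ q)) (cong (∣ q ∣ +_) (∣p⊗q∣≡∣p∣*∣q∣ p q))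
∣p⊗q∣≡∣p∣*∣q∣ {n = n} (outside ∷ p) q =
  trans (∣p++q∣≡∣p∣+∣q∣ (⊥ {n = n}) (p ⊗ q)) (cong₂ _+_ (∣⊥∣≡0 n) (∣p⊗q∣≡∣p∣*∣q∣ p q))

∣p⊗⁅x⁆∣≡∣p∣ : ∀ {m n} (p : Subset m) (x : Fin n) → ∣ p ⊗ ⁅ x ⁆ ∣ ≡ ∣ p ∣
∣p⊗⁅x⁆∣≡∣p∣ p x = trans (∣p⊗q∣≡∣p∣*∣q∣ p ⁅ x ⁆) (trans (cong (∣ p ∣ *_) (∣⁅x⁆∣≡1 x)) (*-identityʳ ∣ p ∣))

lookup-⊗ : ∀ {m n} (p : Subset m) (q : Subset n) i j → lookup (p ⊗ q) (combine i j) ≡ lookup p i ∧ lookup q j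
lookup-⊗ (inside  ∷ p) q zero    j = lookup-++ˡ q (p ⊗ q) j
lookup-⊗ {n = n} (outside ∷ p) q zero j = trans (lookup-++ˡ (⊥ {n = n}) (p ⊗ q) j) (lookup-replicate j outside)
lookup-⊗ (inside  ∷ p) q (suc i) j = trans (lookup-++ʳ q (p ⊗ q) (combine i j)) (lookup-⊗ p q i j)
lookup-⊗ {n = n} (outside ∷ p) q (suc i) j =
  trans (lookup-++ʳ (⊥ {n = n}) (p ⊗ q) (combine i j)) (lookup-⊗ p q i j)

module _ {m n} {p : Subset m} {q : Subset n} {i : Fin m} {j : Fin n} where

  combine∈p⊗q⁺ : i ∈ p → j ∈ q → combine i j ∈ p ⊗ q
  combine∈p⊗q⁺ i∈p j∈q = lookup⇒[]= (combine i j) (p ⊗ q)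
    (trans (lookup-⊗ p q i j) (cong₂ _∧_ ([]=⇒lookup i∈p) ([]=⇒lookup j∈q)))

  combine∈p⊗q⁻ : combine i j ∈ p ⊗ q → i ∈ p × j ∈ q
  combine∈p⊗q⁻ ij∈p⊗q = lookup⇒[]= i p (∧-conicalˡ _ _ both) , lookup⇒[]= j q (∧-conicalʳ _ _ both)
    where
    both : lookup p i ∧ lookup q j ≡ true
    both = trans (sym (lookup-⊗ p q i j)) ([]=⇒lookup ij∈p⊗q)

∀-combine : ∀ {m n ℓ} {P : Pred (Fin (m * n)) ℓ} → (∀ i j → P (combine i j)) → ∀ k → P k
∀-combine {m} {n} {P = P} f k = let i , j = remQuot {m} n k in subst P (combine-remQuot {m} n k) (f i j)

module _ (X : Graph) where

  IsDominatedBy : Subset (order X) → Fin (order X) → Set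
  IsDominatedBy S v = v ∈ S ⊎ ∃ λ u → u ∈ S × Adj X u v

  IsDominatedBy? : ∀ S → Decidable (IsDominatedBy S)
  IsDominatedBy? S v = (v ∈? S) ⊎-dec any? λ u → (u ∈? S) ×-dec T? (adj X u v)

  IsTDS? : Decidable (IsTDS X)
  IsTDS? S = all? λ v → any? λ u → (u ∈? S) ×-dec T? (adj X u v)

  IsMTDS? : Decidable (IsMTDS X)
  IsMTDS? S = IsTDS? S ×-dec map′ (λ ∄ T T⊂S tds → ∄ (T , T⊂S , tds))
                                   (λ minimal (T , T⊂S , tds) → minimal T T⊂S tds)
                                   (¬? (anySubset? λ T → (T ⊂? S) ×-dec IsTDS? T))

  IsPrivateNeighbour : Subset (order X) → Fin (order X) → Fin (order X) → Set
  IsPrivateNeighbour S w v = ∀ u → u ∈ S → Adj X u v → u ≡ w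

  private-neighbour⇒MTDS∋ : ∀ {S} w v → IsTDS X S → IsPrivateNeighbour S w v →
                            ∃ λ T → IsMTDS X T × w ∈ T × ∣ T ∣ ≤ ∣ S ∣
  private-neighbour⇒MTDS∋ {S} w v tds w-only with argmin (λ T → (T ⊆? S) ×-dec IsTDS? T) ∣_∣ (⊆-refl , tds)
  ... | T , (T⊆S , tdsT) , smallest = T , (tdsT , minimal) , w∈T , p⊆q⇒∣p∣≤∣q∣ T⊆S
    where
    minimal : ∀ T′ → T′ ⊂ T → ¬ IsTDS X T′
    minimal T′ T′⊂T tdsT′ = <⇒≱ (p⊂q⇒∣p∣<∣q∣ T′⊂T) (smallest T′ (⊆-trans (p⊂q⇒p⊆q T′⊂T) T⊆S , tdsT′))

    w∈T : w ∈ T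
    w∈T = let u , u∈T , u~v = tdsT v in subst (_∈ T) (w-only u (T⊆S u∈T) u~v) u∈T

module _ (G : Graph) where

  IsIndependent : Subset (order G) → Set
  IsIndependent I = ∀ u v → u ∈ I → v ∈ I → ¬ Adj G u v

  IsIndependent? : Decidable IsIndependent
  IsIndependent? I = all? λ u → all? λ v → (u ∈? I) →-dec (v ∈? I) →-dec ¬? (T? (adj G u v))

  independent-DS⇒MDS : ∀ {I} → IsIndependent I → IsDS G I → IsMDS G I
  independent-DS⇒MDS independent ds = ds , λ { T (T⊆I , x , x∈I , x∉T) dsT →
    [ x∉T , (λ (u , u∈T , u~x) → independent u x (T⊆I u∈T) x∈I u~x) ] (dsT x) }

  module _ (simple : IsSimple G) where

    private
      Adj-sym : ∀ {u v} → Adj G u v → Adj G v u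
      Adj-sym {u} {v} = subst T (proj₁ simple u v)

      loopless : ∀ u → ¬ Adj G u u
      loopless = proj₂ simple

    maximal-independent⇒DS : ∀ {I} → IsIndependent I → (∀ v → v ∉ I → ¬ IsIndependent (I ∪ ⁅ v ⁆)) →
                             IsDS G I
    maximal-independent⇒DS {I} independent maximal v with IsDominatedBy? G I v
    ... | yes dominated = dominated
    ... | no undominated = ⊥-elim (maximal v (undominated ∘ inj₁) independent′)
      where
      independent′ : IsIndependent (I ∪ ⁅ v ⁆)
      independent′ x y x∈ y∈ x~y with x∈p∪q⁻ I ⁅ v ⁆ x∈ | x∈p∪q⁻ I ⁅ v ⁆ y∈
      ... | inj₁ x∈I   | inj₁ y∈I   = independent x y x∈I y∈I x~y
      ... | inj₁ x∈I   | inj₂ y∈⁅v⁆ =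
            undominated (inj₂ (x , x∈I , subst (Adj G x) (x∈⁅y⁆⇒x≡y v y∈⁅v⁆) x~y))
      ... | inj₂ x∈⁅v⁆ | inj₁ y∈I   =
            undominated (inj₂ (y , y∈I , subst (Adj G y) (x∈⁅y⁆⇒x≡y v x∈⁅v⁆) (Adj-sym x~y)))
      ... | inj₂ x∈⁅v⁆ | inj₂ y∈⁅v⁆ =
            loopless v (subst₂ (Adj G) (x∈⁅y⁆⇒x≡y v x∈⁅v⁆) (x∈⁅y⁆⇒x≡y v y∈⁅v⁆) x~y)

    ⁅x⁆-independent : ∀ x → IsIndependent ⁅ x ⁆
    ⁅x⁆-independent x u v u∈ v∈ = loopless x ∘ subst₂ (Adj G) (x∈⁅y⁆⇒x≡y x u∈) (x∈⁅y⁆⇒x≡y x v∈)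

    -- A maximal independent set through a, found as one whose complement is smallest.
    MDS∋ : ∀ a → ∃ λ D → IsMDS G D × a ∈ D
    MDS∋ a with argmin (λ I → (a ∈? I) ×-dec IsIndependent? I) (∣_∣ ∘ ∁) (x∈⁅x⁆ a , ⁅x⁆-independent a)
    ... | I , (a∈I , independent) , largest =
          I , independent-DS⇒MDS independent (maximal-independent⇒DS independent maximal) , a∈I
      where
      maximal : ∀ v → v ∉ I → ¬ IsIndependent (I ∪ ⁅ v ⁆)
      maximal v v∉I independent′ =
        <⇒≱ (p⊂q⇒∣p∣<∣q∣ (p⊂q⇒∁p⊃∁q I⊂I∪⁅v⁆)) (largest (I ∪ ⁅ v ⁆) (x∈p∪q⁺ (inj₁ a∈I) , independent′))
        where
        I⊂I∪⁅v⁆ : I ⊂ I ∪ ⁅ v ⁆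
        I⊂I∪⁅v⁆ = p⊆p∪q ⁅ v ⁆ , v , x∈p∪q⁺ (inj₂ (x∈⁅x⁆ v)) , v∉I

  -- Minimality of D leaves some y undominated by D - a, and y ≠ a because x₀ dominates a.
  external-private-neighbour : (∀ u → ¬ Adj G u u) → ∀ {D a x₀} → IsMDS G D → a ∈ D → x₀ ∈ D → Adj G x₀ a →
                               ∃ λ y → y ∉ D × (∀ x → x ∈ D → Adj G x y → x ≡ a)
  external-private-neighbour loopless {D} {a} {x₀} (_ , minimal) a∈D x₀∈D x₀~a
    with ¬∀⟶∃¬ (order G) (IsDominatedBy G (D - a)) (IsDominatedBy? G (D - a)) (minimal (D - a) (x∈p⇒p-x⊂p a∈D))
  ... | y , undominated = y , y∉D , only-a
    where
    x₀≢a : x₀ ≢ a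
    x₀≢a refl = loopless a x₀~a

    y≢a : y ≢ a
    y≢a refl = undominated (inj₂ (x₀ , x∈p∧x≢y⇒x∈p-y x₀∈D x₀≢a , x₀~a))

    y∉D : y ∉ D
    y∉D y∈D = undominated (inj₁ (x∈p∧x≢y⇒x∈p-y y∈D y≢a))

    only-a : ∀ x → x ∈ D → Adj G x y → x ≡ a
    only-a x x∈D x~y with x ≟ a
    ... | yes x≡a = x≡a
    ... | no x≢a = ⊥-elim (undominated (inj₂ (x , x∈p∧x≢y⇒x∈p-y x∈D x≢a , x~y)))

module _ (G H : Graph) {x y : Fin (order G)} {c d : Fin (order H)} where

  adj-∘G : adj (G ∘G H) (combine x c) (combine y d) ≡ adj G x y ∨ (⌊ x ≟ y ⌋ ∧ adj H c d)
  adj-∘G = cong₂ (λ (x , c) (y , d) → adj G x y ∨ (⌊ x ≟ y ⌋ ∧ adj H c d))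
                 (remQuot-combine {k = order H} x c) (remQuot-combine {k = order H} y d)

  Adj-∘G⁻ : Adj (G ∘G H) (combine x c) (combine y d) → Adj G x y ⊎ (x ≡ y × Adj H c d)
  Adj-∘G⁻ xc~yd with x ≟ y | subst T adj-∘G xc~yd
  ... | yes refl | x~y⊎c~d = Sum.map₂ (refl ,_) (T-∨ .to x~y⊎c~d)
  ... | no _     | x~y⊎⊥   = [ inj₁ , ⊥-elim ] (T-∨ .to x~y⊎⊥)

  Adj-∘G⁺ : Adj G x y ⊎ (x ≡ y × Adj H c d) → Adj (G ∘G H) (combine x c) (combine y d)
  Adj-∘G⁺ x~y⊎c~d = subst T (sym adj-∘G) (T-∨ .from (Sum.map₂ lift x~y⊎c~d))
    where
    lift : x ≡ y × Adj H c d → T (⌊ x ≟ y ⌋ ∧ adj H c d)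
    lift (refl , c~d) with x ≟ x
    ... | yes _ = c~d
    ... | no x≢x = x≢x refl

module _ {n : ℕ} {c d : Fin n} where

  Adj-K⁺ : c ≢ d → Adj (K n) c d
  Adj-K⁺ c≢d with c ≟ d
  ... | yes c≡d = c≢d c≡d
  ... | no _ = _

  Adj-K⁻ : Adj (K n) c d → c ≢ d
  Adj-K⁻ with c ≟ d
  ... | yes _ = λ ()
  ... | no c≢d = λ _ → c≢d

∃≢ : ∀ {n} → n ≥ 2 → (b : Fin n) → ∃ λ b′ → b′ ≢ b
∃≢ (s≤s (s≤s z≤n)) b = punchIn b zero , punchInᵢ≢i b zero

module _ (G : Graph) (n : ℕ) where

  private
    H : Graph
    H = G ∘G K n

  layers : Subset (order G) → Fin n → Subset (order G) → Fin n → Subset (order H)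
  layers D b D′ b′ = D ⊗ ⁅ b ⁆ ∪ D′ ⊗ ⁅ b′ ⁆

  module _ {D D′ : Subset (order G)} {b b′ : Fin n} where

    ∈layers⁺ˡ : ∀ {x} → x ∈ D → combine x b ∈ layers D b D′ b′
    ∈layers⁺ˡ x∈D = x∈p∪q⁺ (inj₁ (combine∈p⊗q⁺ x∈D (x∈⁅x⁆ b)))

    ∈layers⁺ʳ : ∀ {x} → x ∈ D′ → combine x b′ ∈ layers D b D′ b′
    ∈layers⁺ʳ x∈D′ = x∈p∪q⁺ (inj₂ (combine∈p⊗q⁺ x∈D′ (x∈⁅x⁆ b′)))

    ∈layers⁻ : ∀ {x c} → combine x c ∈ layers D b D′ b′ → (x ∈ D × c ≡ b) ⊎ (x ∈ D′ × c ≡ b′)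
    ∈layers⁻ xc∈ = Sum.map layer layer (x∈p∪q⁻ (D ⊗ ⁅ b ⁆) (D′ ⊗ ⁅ b′ ⁆) xc∈)
      where
      layer : ∀ {E e x c} → combine x c ∈ E ⊗ ⁅ e ⁆ → x ∈ E × c ≡ e
      layer {e = e} xc∈E⊗e = let x∈E , c∈⁅e⁆ = combine∈p⊗q⁻ xc∈E⊗e in x∈E , x∈⁅y⁆⇒x≡y e c∈⁅e⁆

    ∣layers∣≤2∣D∣ : D′ ⊆ D → ∣ layers D b D′ b′ ∣ ≤ 2 * ∣ D ∣
    ∣layers∣≤2∣D∣ D′⊆D = begin
      ∣ D ⊗ ⁅ b ⁆ ∪ D′ ⊗ ⁅ b′ ⁆ ∣     ≤⟨ ∣p∪q∣≤∣p∣+∣q∣ (D ⊗ ⁅ b ⁆) (D′ ⊗ ⁅ b′ ⁆) ⟩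
      ∣ D ⊗ ⁅ b ⁆ ∣ + ∣ D′ ⊗ ⁅ b′ ⁆ ∣ ≡⟨ cong₂ _+_ (∣p⊗⁅x⁆∣≡∣p∣ D b) (∣p⊗⁅x⁆∣≡∣p∣ D′ b′) ⟩
      ∣ D ∣ + ∣ D′ ∣                   ≤⟨ +-monoʳ-≤ ∣ D ∣ (p⊆q⇒∣p∣≤∣q∣ D′⊆D) ⟩
      ∣ D ∣ + ∣ D ∣                    ≡⟨ cong (∣ D ∣ +_) (+-identityʳ ∣ D ∣) ⟨
      2 * ∣ D ∣                        ∎
      where open ≤-Reasoning

    layers-TDS : b′ ≢ b → D′ ⊆ D → (∀ z → z ∈ D′ ⊎ ∃ λ x → x ∈ D × Adj G x z) → IsTDS H (layers D b D′ b′)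
    layers-TDS b′≢b D′⊆D covered = ∀-combine λ z c → dominate z c (covered z)
      where
      dominate : ∀ z c → z ∈ D′ ⊎ (∃ λ x → x ∈ D × Adj G x z) →
                 ∃ λ u → u ∈ layers D b D′ b′ × Adj H u (combine z c)
      dominate z c (inj₂ (x , x∈D , x~z)) = combine x b , ∈layers⁺ˡ x∈D , Adj-∘G⁺ G (K n) (inj₁ x~z)
      dominate z c (inj₁ z∈D′) with c ≟ b
      ... | yes refl = combine z b′ , ∈layers⁺ʳ z∈D′ , Adj-∘G⁺ G (K n) (inj₂ (refl , Adj-K⁺ b′≢b))
      ... | no c≢b   = combine z b , ∈layers⁺ˡ (D′⊆D z∈D′) , Adj-∘G⁺ G (K n) (inj₂ (refl , Adj-K⁺ (c≢b ∘ sym)))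

    isolated⇒private : D′ ⊆ D → ∀ {a} → (∀ x → x ∈ D → ¬ Adj G x a) →
                       IsPrivateNeighbour H (layers D b D′ b′) (combine a b) (combine a b′)
    isolated⇒private D′⊆D {a} isolated =
      ∀-combine λ x c xc∈ xc~ab′ → neighbour x c (∈layers⁻ xc∈) (Adj-∘G⁻ G (K n) xc~ab′)
      where
      neighbour : ∀ x c → (x ∈ D × c ≡ b) ⊎ (x ∈ D′ × c ≡ b′) → Adj G x a ⊎ (x ≡ a × Adj (K n) c b′) →
                  combine x c ≡ combine a b
      neighbour x c (inj₁ (x∈D , _))    (inj₁ x~a)        = ⊥-elim (isolated x x∈D x~a)
      neighbour x c (inj₂ (x∈D′ , _))   (inj₁ x~a)        = ⊥-elim (isolated x (D′⊆D x∈D′) x~a)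
      neighbour x c (inj₁ (_ , refl))   (inj₂ (refl , _)) = refl
      neighbour x c (inj₂ (_ , refl))   (inj₂ (_ , c~b′)) = ⊥-elim (Adj-K⁻ c~b′ refl)

    external⇒private : D′ ⊆ D → ∀ {a y} → a ∉ D′ → y ∉ D → (∀ x → x ∈ D → Adj G x y → x ≡ a) →
                       IsPrivateNeighbour H (layers D b D′ b′) (combine a b) (combine y b)
    external⇒private D′⊆D {a} {y} a∉D′ y∉D only-a =
      ∀-combine λ x c xc∈ xc~yb → neighbour x c (∈layers⁻ xc∈) (Adj-∘G⁻ G (K n) xc~yb)
      where
      neighbour : ∀ x c → (x ∈ D × c ≡ b) ⊎ (x ∈ D′ × c ≡ b′) → Adj G x y ⊎ (x ≡ y × Adj (K n) c b) →
                  combine x c ≡ combine a b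
      neighbour x c (inj₁ (x∈D , refl)) (inj₁ x~y)        = cong (λ x → combine x b) (only-a x x∈D x~y)
      neighbour x c (inj₂ (x∈D′ , _))   (inj₁ x~y)        =
        ⊥-elim (a∉D′ (subst (_∈ D′) (only-a x (D′⊆D x∈D′) x~y) x∈D′))
      neighbour x c (inj₁ (x∈D , _))    (inj₂ (refl , _)) = ⊥-elim (y∉D x∈D)
      neighbour x c (inj₂ (x∈D′ , _))   (inj₂ (refl , _)) = ⊥-elim (y∉D (D′⊆D x∈D′))

    layers⇒MTDS∋ : b′ ≢ b → D′ ⊆ D → (∀ z → z ∈ D′ ⊎ ∃ λ x → x ∈ D × Adj G x z) →
                   ∀ {w v} → IsPrivateNeighbour H (layers D b D′ b′) w v →
                   ∃ λ T → IsMTDS H T × w ∈ T × ∣ T ∣ ≤ 2 * ∣ D ∣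
    layers⇒MTDS∋ b′≢b D′⊆D covered {w} {v} w-only
      with private-neighbour⇒MTDS∋ H w v (layers-TDS b′≢b D′⊆D covered) w-only
    ... | T , mtds , w∈T , ∣T∣≤∣S∣ = T , mtds , w∈T , ≤-trans ∣T∣≤∣S∣ (∣layers∣≤2∣D∣ D′⊆D)

  MTDS∋-bounded : (∀ u → ¬ Adj G u u) → n ≥ 2 → ∀ {D a} → IsMDS G D → a ∈ D → (b : Fin n) →
                  ∃ λ T → IsMTDS H T × combine a b ∈ T × ∣ T ∣ ≤ 2 * ∣ D ∣
  MTDS∋-bounded loopless n≥2 {D} {a} mds@(ds , _) a∈D b
    with ∃≢ n≥2 b | any? (λ x → (x ∈? D) ×-dec T? (adj G x a))
  ... | b′ , b′≢b | no isolated =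
        layers⇒MTDS∋ b′≢b ⊆-refl ds (isolated⇒private ⊆-refl λ x x∈D x~a → isolated (x , x∈D , x~a))
  ... | b′ , b′≢b | yes (x₀ , x₀∈D , x₀~a) with external-private-neighbour G loopless mds a∈D x₀∈D x₀~a
  ...   | y , y∉D , only-a =
          layers⇒MTDS∋ b′≢b D-a⊆D covered (external⇒private D-a⊆D (x∉p-x D a) y∉D only-a)
    where
    D-a⊆D : D - a ⊆ D
    D-a⊆D = p─q⊆p D ⁅ a ⁆

    covered : ∀ z → z ∈ D - a ⊎ ∃ λ x → x ∈ D × Adj G x z
    covered z with z ≟ a
    ... | yes refl = inj₂ (x₀ , x₀∈D , x₀~a)
    ... | no z≢a   = Sum.map₁ (λ z∈D → x∈p∧x≢y⇒x∈p-y z∈D z≢a) (ds z)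

theorem9 : (G : Graph) → IsSimple G → (n : ℕ) → n ≥ 2 → NonCompliant G →
    Compliant (G ∘G K n)
    × (∀ (a : Fin (order G)) (b : Fin n) (d : ℕ) → IsDomDegree G a d →
         ∃ λ t → IsTotalDomDegree (G ∘G K n) (vtx G (K n) a b) t × t ≤ 2 * d)
theorem9 G simple@(_ , loopless) n n≥2 _ = compliant , degree
  where
  compliant : Compliant (G ∘G K n)
  compliant = ∀-combine λ a b →
    let D , mds , a∈D = MDS∋ G simple a
        T , mtds , ab∈T , _ = MTDS∋-bounded G n loopless n≥2 mds a∈D b
    in T , mtds , ab∈T

  degree : ∀ a b d → IsDomDegree G a d → ∃ λ t → IsTotalDomDegree (G ∘G K n) (vtx G (K n) a b) t × t ≤ 2 * d
  degree a b _ ((D , (mds , a∈D) , refl) , _) =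
    let T , mtds , ab∈T , ∣T∣≤2∣D∣ = MTDS∋-bounded G n loopless n≥2 mds a∈D b
        t , isDegree , t≤∣T∣ = minCard (λ S → IsMTDS? (G ∘G K n) S ×-dec (combine a b ∈? S)) (mtds , ab∈T)
    in t , isDegree , ≤-trans t≤∣T∣ ∣T∣≤2∣D∣
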